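{- Let $\models_{\mathsf{CC/TT}}$ be the consequence relation of the logic $\mathsf{CC/TT}$ described in the context, and let $A\supset B$ abbreviate $\neg(A\wedge\neg B)$. Then for all formulae $A,B$: (1) $A\to B\models_{\mathsf{CC/TT}}A\supset B$, but in general $A\supset B\not\models_{\mathsf{CC/TT}}A\to B$; (2) $\models_{\mathsf{CC/TT}}(A\supset B)\supset\!\subset(A\to B)$; (3) in general $\not\models_{\mathsf{CC/TT}}(A\supset B)\leftrightarrow(A\to B)$.
   Context: Formulae are built from propositional variables with $\neg,\wedge,\vee,\to$. A $\mathsf{CC}$-evaluation is a map $v$ from formulae to $\{0,\tfrac12,1\}$ satisfying the Strong Kleene clauses $v(\neg A)=1-v(A)$, $v(A\wedge B)=\min(v(A),v(B))$, $v(A\vee B)=\max(v(A),v(B))$, and the Cooper–Cantwell clause for the conditional: $v(A\to B)=v(B)$ if $v(A)\in\{1,\tfrac12\}$, and $v(A\to B)=\tfrac12$ if $v(A)=0$. Consequence is tolerant-to-tolerant: $A\models_{\mathsf{CC/TT}}C$ iff for every $\mathsf{CC}$-evaluation $v$, $v(A)\in\{\tfrac12,1\}$ implies $v(C)\in\{\tfrac12,1\}$; and $\models_{\mathsf{CC/TT}}C$ iff $v(C)\in\{\tfrac12,1\}$ for every $\mathsf{CC}$-evaluation $v$. The material conditional $A\supset B$ is $\neg(A\wedge\neg B)$; the material biconditional $A\supset\!\subset B$ is $(A\supset B)\wedge(B\supset A)$ and the indicative biconditional $A\leftrightarrow B$ is $(A\to B)\wedge(B\to A)$. -}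

module Defs where

open import Data.Nat using (ℕ)
open import Data.Product using (Σ; _×_; _,_)
open import Relation.Binary.PropositionalEquality using (_≡_)

data Formula : Set where
  var  : ℕ → Formula
  ¬'_  : Formula → Formula
  _∧'_ : Formula → Formula → Formula
  _∨'_ : Formula → Formula → Formula
  _⇒_  : Formula → Formula → Formula   -- the indicative conditional →

infix  9 ¬'_
infixr 7 _∧'_
infixr 6 _∨'_
infixr 5 _⇒_

data V : Set where
  v0 vh v1 : V

neg : V → V
neg v0 = v1
neg vh = vh
neg v1 = v0

vmin : V → V → V
vmin v0 _  = v0
vmin vh v0 = v0
vmin vh _  = vh
vmin v1 y  = y

vmax : V → V → V
vmax v0 y  = y
vmax vh v1 = v1
vmax vh _  = vh
vmax v1 _  = v1

cc : V → V → V
cc v0 _ = vh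
cc vh y = y
cc v1 y = y

record CCEval : Set where
  field
    val   : Formula → V
    val-¬ : ∀ A → val (¬' A) ≡ neg (val A)
    val-∧ : ∀ A B → val (A ∧' B) ≡ vmin (val A) (val B)
    val-∨ : ∀ A B → val (A ∨' B) ≡ vmax (val A) (val B)
    val-⇒ : ∀ A B → val (A ⇒ B) ≡ cc (val A) (val B)
open CCEval public

data Tol : V → Set where
  tol-h : Tol vh
  tol-1 : Tol v1

_⊨_ : Formula → Formula → Set
A ⊨ C = (v : CCEval) → Tol (val v A) → Tol (val v C)

⊨_ : Formula → Set
⊨ C = (v : CCEval) → Tol (val v C)

infix 2 _⊨_ ⊨_

_⊃_ : Formula → Formula → Formula
A ⊃ B = ¬' (A ∧' ¬' B)

_⊃⊂_ : Formula → Formula → Formula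
A ⊃⊂ B = (A ⊃ B) ∧' (B ⊃ A)

_⇔'_ : Formula → Formula → Formula
A ⇔' B = (A ⇒ B) ∧' (B ⇒ A)

infixr 5 _⊃_
infix 4 _⊃⊂_ _⇔'_

module Submission where

-- Every connective is evaluated truth-functionally, so each claim about the
-- compound formulae reduces to a claim about the three-valued operations.
-- For the negative claims we build the CC-evaluation induced by an
-- assignment of values to variables (evalFrom) and use the countermodel
-- v(p) = 1/2, v(q) = 0: there p ⊃ q is 1/2 while p → q is 0, so p ⊃ q does
-- not entail p → q; and (p ⊃ q) ↔ (p → q) takes the value 0, because its
-- first conjunct (p ⊃ q) → (p → q) has a tolerated antecedent and so takes
-- the value of its consequent, v(p → q) = 0.

open import Defs
open import Data.Product using (Σ; _×_; _,_)
open import Data.Nat using (ℕ; zero; suc)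
open import Relation.Nullary using (¬_)
open import Relation.Binary.PropositionalEquality
  using (_≡_; refl; sym; trans; cong; cong₂; subst)

_⊃ᵥ_ : V → V → V
a ⊃ᵥ b = neg (vmin a (neg b))

_⊃⊂ᵥ_ : V → V → V
a ⊃⊂ᵥ b = vmin (a ⊃ᵥ b) (b ⊃ᵥ a)

_⇔ᵥ_ : V → V → V
a ⇔ᵥ b = vmin (cc a b) (cc b a)

module _ (v : CCEval) where

  ⊃-value : ∀ A B → val v (A ⊃ B) ≡ val v A ⊃ᵥ val v B
  ⊃-value A B = begin
    val v (¬' (A ∧' ¬' B))        ≡⟨ val-¬ v _ ⟩
    neg (val v (A ∧' ¬' B))       ≡⟨ cong neg (val-∧ v A (¬' B)) ⟩
    neg (vmin (val v A) (val v (¬' B)))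
                                  ≡⟨ cong (λ x → neg (vmin (val v A) x)) (val-¬ v B) ⟩
    val v A ⊃ᵥ val v B            ∎
    where open Relation.Binary.PropositionalEquality.≡-Reasoning

  ⊃⊂-value : ∀ A B → val v (A ⊃⊂ B) ≡ val v A ⊃⊂ᵥ val v B
  ⊃⊂-value A B = trans (val-∧ v (A ⊃ B) (B ⊃ A)) (cong₂ vmin (⊃-value A B) (⊃-value B A))

  ⇔-value : ∀ A B → val v (A ⇔' B) ≡ val v A ⇔ᵥ val v B
  ⇔-value A B = trans (val-∧ v (A ⇒ B) (B ⇒ A)) (cong₂ vmin (val-⇒ v A B) (val-⇒ v B A))

-- Truth table for (1): whenever the CC conditional is tolerated, so is the
-- material one (the only difference is a = 0, where the latter is 1).
cc-tol⇒⊃-tol : ∀ a b → Tol (cc a b) → Tol (a ⊃ᵥ b)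
cc-tol⇒⊃-tol v0 b  _ = tol-1
cc-tol⇒⊃-tol vh v0 ()
cc-tol⇒⊃-tol vh vh _ = tol-h
cc-tol⇒⊃-tol vh v1 _ = tol-1
cc-tol⇒⊃-tol v1 v0 ()
cc-tol⇒⊃-tol v1 vh _ = tol-h
cc-tol⇒⊃-tol v1 v1 _ = tol-1

-- Truth table for (2): the two conditionals never receive values 1 and 0
-- respectively (in either order), so their material biconditional is tolerated.
⊃⊂-tol : ∀ a b → Tol ((a ⊃ᵥ b) ⊃⊂ᵥ cc a b)
⊃⊂-tol v0 v0 = tol-h
⊃⊂-tol v0 vh = tol-h
⊃⊂-tol v0 v1 = tol-h
⊃⊂-tol vh v0 = tol-h
⊃⊂-tol vh vh = tol-h
⊃⊂-tol vh v1 = tol-1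
⊃⊂-tol v1 v0 = tol-1
⊃⊂-tol v1 vh = tol-h
⊃⊂-tol v1 v1 = tol-1

eval : (ℕ → V) → Formula → V
eval s (var n)  = s n
eval s (¬' A)   = neg (eval s A)
eval s (A ∧' B) = vmin (eval s A) (eval s B)
eval s (A ∨' B) = vmax (eval s A) (eval s B)
eval s (A ⇒ B)  = cc (eval s A) (eval s B)

evalFrom : (ℕ → V) → CCEval
evalFrom s = record
  { val   = eval s
  ; val-¬ = λ _ → refl
  ; val-∧ = λ _ _ → refl
  ; val-∨ = λ _ _ → refl
  ; val-⇒ = λ _ _ → refl
  }

p q : Formula
p = var 0
q = var 1

halfThenFalse : ℕ → V
halfThenFalse zero    = vh
halfThenFalse (suc _) = v0

counter : CCEval
counter = evalFrom halfThenFalse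

¬tol-v0 : ¬ Tol v0
¬tol-v0 ()

mainTheorem2 : ((A B : Formula) → (A ⇒ B) ⊨ (A ⊃ B))
    × Σ Formula (λ A → Σ Formula (λ B → ¬ ((A ⊃ B) ⊨ (A ⇒ B))))
    × ((A B : Formula) → ⊨ ((A ⊃ B) ⊃⊂ (A ⇒ B)))
    × Σ Formula (λ A → Σ Formula (λ B → ¬ (⊨ ((A ⊃ B) ⇔' (A ⇒ B)))))
mainTheorem2 = material-of-cc , (p , q , ⊃-not-⊨-cc) , biconditional , (p , q , ⇔-invalid)
  where
  material-of-cc : (A B : Formula) → (A ⇒ B) ⊨ (A ⊃ B)
  material-of-cc A B v t = subst Tol (sym (⊃-value v A B))
    (cc-tol⇒⊃-tol (val v A) (val v B) (subst Tol (val-⇒ v A B) t))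

  ⊃-not-⊨-cc : ¬ ((p ⊃ q) ⊨ (p ⇒ q))
  ⊃-not-⊨-cc h = ¬tol-v0 (h counter tol-h)

  biconditional : (A B : Formula) → ⊨ ((A ⊃ B) ⊃⊂ (A ⇒ B))
  biconditional A B v = subst Tol (sym eq) (⊃⊂-tol (val v A) (val v B))
    where
    eq : val v ((A ⊃ B) ⊃⊂ (A ⇒ B)) ≡ (val v A ⊃ᵥ val v B) ⊃⊂ᵥ cc (val v A) (val v B)
    eq = trans (⊃⊂-value v (A ⊃ B) (A ⇒ B)) (cong₂ _⊃⊂ᵥ_ (⊃-value v A B) (val-⇒ v A B))

  ⇔-invalid : ¬ (⊨ ((p ⊃ q) ⇔' (p ⇒ q)))
  ⇔-invalid h = ¬tol-v0 (subst Tol (⇔-value counter (p ⊃ q) (p ⇒ q)) (h counter))
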